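{- Let $N=\{p^{\lambda},\ p^{\lambda}q,\ p^2q^2,\ pqr,\ p^2qr,\ pqrs : p,q,r,s \text{ distinct primes},\ \lambda\geqslant 1\}$. Let $n\in N$ and let $S$ be a square-free subset of $\mathbb{Z}_n$ with $|S|\mid n$ and $\gcd(|S|,n/|S|)=1$, such that the Cayley sum graph $\mathrm{CS}(\mathbb{Z}_n,S)$ is connected. Then $\mathrm{CS}(\mathbb{Z}_n,S)$ admits a total perfect code if and only if $s\not\equiv s'\pmod{|S|}$ for all distinct $s,s'\in S$.
   Context: For an abelian group $G$ and $S\subseteq G$, the Cayley sum graph $\mathrm{CS}(G,S)$ has vertex set $G$, two vertices $g,h$ adjacent iff $g+h\in S$ and $g\neq h$. A total perfect code of a graph is a set $C$ of vertices such that every vertex has exactly one neighbor in $C$. $S$ is square-free if it contains no element of the form $y+y$, $y\in G$. Elements of $\mathbb{Z}_n$ are identified with integers $0,\dots,n-1$. -}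

module Defs where

open import Data.Nat using (ℕ; zero; suc; _+_; _*_; _^_; _≥_; NonZero; ∣_-_∣)
open import Data.Nat.DivMod using (_%_; m%n<n)
open import Data.Nat.Divisibility using (_∣_)
open import Data.Nat.Primality using (Prime)
open import Data.Fin using (Fin; toℕ; fromℕ<)
open import Data.Fin.Subset using (Subset; _∈_; _∉_; ∣_∣)
open import Data.Product using (Σ; ∃; _×_; _,_)
open import Data.Sum using (_⊎_)
open import Relation.Binary.PropositionalEquality using (_≡_; _≢_)

_⊕_ : ∀ {n} .{{_ : NonZero n}} → Fin n → Fin n → Fin n
_⊕_ {n} a b = fromℕ< (m%n<n (toℕ a + toℕ b) n)

Adj : ∀ {n} .{{_ : NonZero n}} → Subset n → Fin n → Fin n → Set
Adj S g h = (g ⊕ h) ∈ S × g ≢ h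

data Walk {n} .{{_ : NonZero n}} (S : Subset n) : Fin n → Fin n → Set where
  here : ∀ {g} → Walk S g g
  step : ∀ {g h k} → Adj S g h → Walk S h k → Walk S g k

Connected : ∀ {n} .{{_ : NonZero n}} → Subset n → Set
Connected {n} S = (g h : Fin n) → Walk S g h

IsTotalPerfectCode : ∀ {n} .{{_ : NonZero n}} → Subset n → Subset n → Set
IsTotalPerfectCode {n} S C =
  (v : Fin n) → Σ (Fin n) λ c → (c ∈ C × Adj S v c) ×
                  ((c′ : Fin n) → c′ ∈ C → Adj S v c′ → c′ ≡ c)

HasTotalPerfectCode : ∀ {n} .{{_ : NonZero n}} → Subset n → Set
HasTotalPerfectCode {n} S = Σ (Subset n) λ C → IsTotalPerfectCode S C

SquareFree : ∀ {n} .{{_ : NonZero n}} → Subset n → Set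
SquareFree {n} S = (y : Fin n) → (y ⊕ y) ∉ S

_≡_[mod_] : ℕ → ℕ → ℕ → Set
a ≡ b [mod k ] = k ∣ ∣ a - b ∣

data InN (n : ℕ) : Set where
  form1 : ∀ p l → Prime p → l ≥ 1 → n ≡ p ^ l → InN n
  form2 : ∀ p q l → Prime p → Prime q → p ≢ q → l ≥ 1 → n ≡ p ^ l * q → InN n
  form3 : ∀ p q → Prime p → Prime q → p ≢ q → n ≡ p ^ 2 * q ^ 2 → InN n
  form4 : ∀ p q r → Prime p → Prime q → Prime r → p ≢ q → p ≢ r → q ≢ r →
          n ≡ p * q * r → InN n
  form5 : ∀ p q r → Prime p → Prime q → Prime r → p ≢ q → p ≢ r → q ≢ r →
          n ≡ p ^ 2 * q * r → InN n
  form6 : ∀ p q r s → Prime p → Prime q → Prime r → Prime s →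
          p ≢ q → p ≢ r → p ≢ s → q ≢ r → q ≢ s → r ≢ s →
          n ≡ p * q * r * s → InN n

module Submission where

-- If the elements of S are pairwise incongruent modulo k = |S|, then S meets every residue
-- class mod k exactly once, and the multiples of k form a total perfect code: the unique
-- neighbour of v in kℤₙ is s − v, where s is the element of S with s ≡ v (mod k).
--
-- Conversely, a total perfect code C makes S ⊕ (−C) a tiling of ℤₙ. For a prime p ∤ |S| the
-- Frobenius identity S^p = pS in 𝔽ₚ[ℤₙ] shows that (pS) ⊕ (−C) covers every residue a number
-- of times ≡ |S|^(p−1) ≢ 0 (mod p); as the total count is n, every residue is covered once,
-- so pS ⊕ (−C) is again a tiling. Running through the prime factors of m = n/k, which are
-- coprime to k, mS ⊕ (−C) tiles ℤₙ, so s ↦ ms is injective on S modulo n = km: distinct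
-- elements of S are incongruent modulo k.

open import Algebra.Bundles using (CommutativeSemiring)
open import Algebra.Structures using (IsCommutativeSemiring)
import Algebra.Structures.Biased as Biased
open import Data.Bool.Base using (true; false)
open import Data.Nat.Base
open import Data.Nat.Properties
open import Algebra.Properties.CommutativeSemigroup +-commutativeSemigroup
  using (interchange; x∙yz≈y∙xz; xy∙z≈xz∙y)
open import Data.Nat.Combinatorics using (_C_; nCn≡1; nC1≡n; nCk+nC[k+1]≡[n+1]C[k+1])
open import Data.Nat.Coprimality using (Coprime; gcd≡1⇒coprime)
import Data.Nat.Coprimality as Coprime
open import Data.Nat.DivMod
open import Data.Nat.Divisibility
open import Data.Nat.GCD using (gcd)
open import Data.Nat.ListAction using (sum; product)
open import Data.Nat.ListAction.Properties using (sum-++)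
open import Data.Nat.Primality
open import Data.Nat.Primality.Factorisation using (PrimeFactorisation; factorise)
open import Data.Nat.Tactic.RingSolver using (solve-∀)
open import Data.Fin.Base using (Fin; zero; suc; toℕ; fromℕ; fromℕ<; inject₁)
open import Data.Fin.Properties
  using (toℕ-fromℕ; toℕ-fromℕ<; toℕ-inject₁; toℕ<n; toℕ-injective)
  renaming (_≟_ to _≟ᶠ_; suc-injective to Fin-suc-injective)
open import Data.Fin.Subset using (Subset; _∈_; ∣_∣)
open import Data.Vec.Base using ([]; _∷_; here; there; tabulate)
open import Data.Vec.Properties using (lookup∘tabulate; []=⇒lookup; lookup⇒[]=)
open import Data.List.Base
  using (List; []; _∷_; _++_; map; length; upTo; cartesianProductWith)
open import Data.List.Properties
  using (map-++; map-∘; map-cong; map-id; length-++; length-map; length-upTo;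
         ++-assoc; cartesianProductWith-distribʳ-++)
open import Data.List.Membership.Propositional using () renaming (_∈_ to _∈ₗ_)
open import Data.List.Membership.Propositional.Properties
  using (∈-map⁺; ∈-map⁻; ∈-upTo⁺; ∈-upTo⁻)
open import Data.List.Relation.Unary.Any using (here; there)
open import Data.List.Relation.Unary.All as All using (All; []; _∷_)
import Data.List.Relation.Unary.All.Properties as All
open import Data.List.Relation.Unary.Unique.Propositional using (Unique; []; _∷_)
import Data.List.Relation.Unary.Unique.Propositional.Properties as Unique
open import Data.Product using (Σ; _×_; _,_; proj₁; proj₂)
open import Data.Sum using (inj₁; inj₂)
open import Data.Empty using (⊥-elim)
open import Function.Base using (_∘_)
open import Function.Bundles using (_⇔_; mk⇔)
open import Relation.Binary.PropositionalEquality hiding (setoid)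
open import Relation.Binary.Structures using (IsEquivalence)
open import Relation.Nullary using (¬_; yes; no; does; contradiction)
open import Relation.Nullary.Decidable using (dec-true)
open import Defs

private variable
  A B : Set

∑ : List A → (A → ℕ) → ℕ
∑ xs f = sum (map f xs)

∑-cong : ∀ (xs : List A) {f g} → (∀ x → f x ≡ g x) → ∑ xs f ≡ ∑ xs g
∑-cong xs f≗g = cong sum (map-cong f≗g xs)

∑-map : ∀ (g : A → B) xs f → ∑ (map g xs) f ≡ ∑ xs (f ∘ g)
∑-map g xs f = cong sum (sym (map-∘ xs))

∑-++ : ∀ (xs ys : List A) f → ∑ (xs ++ ys) f ≡ ∑ xs f + ∑ ys f
∑-++ xs ys f = trans (cong sum (map-++ f xs ys)) (sum-++ (map f xs) (map f ys))

∑-++-comm : ∀ (xs ys : List A) f → ∑ (xs ++ ys) f ≡ ∑ (ys ++ xs) f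
∑-++-comm xs ys f =
  trans (∑-++ xs ys f) (trans (+-comm (∑ xs f) (∑ ys f)) (sym (∑-++ ys xs f)))

∑-+ : ∀ (xs : List A) f g → ∑ xs (λ x → f x + g x) ≡ ∑ xs f + ∑ xs g
∑-+ []       f g = refl
∑-+ (x ∷ xs) f g = trans (cong (f x + g x +_) (∑-+ xs f g)) (interchange (f x) (g x) _ _)

∑-const-0 : ∀ (xs : List A) → ∑ xs (λ _ → 0) ≡ 0
∑-const-0 []       = refl
∑-const-0 (x ∷ xs) = ∑-const-0 xs

∑-1≡length : ∀ (xs : List A) → ∑ xs (λ _ → 1) ≡ length xs
∑-1≡length []       = refl
∑-1≡length (x ∷ xs) = cong suc (∑-1≡length xs)

∑-swap : ∀ (xs : List A) (ys : List B) (f : A → B → ℕ) →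
         ∑ xs (λ x → ∑ ys (f x)) ≡ ∑ ys (λ y → ∑ xs (λ x → f x y))
∑-swap []       ys f = sym (∑-const-0 ys)
∑-swap (x ∷ xs) ys f = trans (cong (∑ ys (f x) +_) (∑-swap xs ys f))
                             (sym (∑-+ ys (f x) (λ y → ∑ xs (λ x′ → f x′ y))))

∑-mono-≤ : ∀ (xs : List A) {f g} → (∀ x → f x ≤ g x) → ∑ xs f ≤ ∑ xs g
∑-mono-≤ []       f≤g = z≤n
∑-mono-≤ (x ∷ xs) f≤g = +-mono-≤ (f≤g x) (∑-mono-≤ xs f≤g)

∑-≥-∈ : ∀ {xs : List A} {x} f → x ∈ₗ xs → f x ≤ ∑ xs f
∑-≥-∈ f (here refl) = m≤m+n _ _
∑-≥-∈ f (there x∈)  = ≤-trans (∑-≥-∈ f x∈) (m≤n+m _ _)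

∑-≥-pair : ∀ {xs : List A} {x y} f → x ∈ₗ xs → y ∈ₗ xs → x ≢ y → f x + f y ≤ ∑ xs f
∑-≥-pair f (here refl) (here refl) x≢y = ⊥-elim (x≢y refl)
∑-≥-pair f (here refl) (there y∈)  _   = +-monoʳ-≤ (f _) (∑-≥-∈ f y∈)
∑-≥-pair {xs = y ∷ ys} {x} f (there x∈) (here refl) _ =
  subst (_≤ f y + ∑ ys f) (+-comm (f y) (f x)) (+-monoʳ-≤ (f y) (∑-≥-∈ f x∈))
∑-≥-pair f (there x∈)  (there y∈)  x≢y = ≤-trans (∑-≥-pair f x∈ y∈ x≢y) (m≤n+m _ _)

+-tight : ∀ {a b c d} → a ≤ c → b ≤ d → a + b ≡ c + d → a ≡ c × b ≡ d
+-tight {a} {b} {c} {d} a≤c b≤d sum≡ =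
  a≡c , +-cancelˡ-≡ a b d (trans sum≡ (cong (_+ d) (sym a≡c)))
  where
  a≡c : a ≡ c
  a≡c = ≤-antisym a≤c
    (+-cancelʳ-≤ b c a (≤-trans (+-monoʳ-≤ c b≤d) (≤-reflexive (sym sum≡))))

∑-tight : ∀ (xs : List A) {f g} → (∀ x → f x ≤ g x) → ∑ xs f ≡ ∑ xs g →
          ∀ {x} → x ∈ₗ xs → f x ≡ g x
∑-tight (y ∷ ys) f≤g ∑≡ (here refl) = proj₁ (+-tight (f≤g y) (∑-mono-≤ ys f≤g) ∑≡)
∑-tight (y ∷ ys) f≤g ∑≡ (there x∈)  =
  ∑-tight ys f≤g (proj₂ (+-tight (f≤g y) (∑-mono-≤ ys f≤g) ∑≡)) x∈

∑-≡0 : ∀ (xs : List A) {f} → (∀ {x} → x ∈ₗ xs → f x ≡ 0) → ∑ xs f ≡ 0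
∑-≡0 []       f≡0 = refl
∑-≡0 (x ∷ xs) f≡0 = cong₂ _+_ (f≡0 (here refl)) (∑-≡0 xs (f≡0 ∘ there))

∑-≡-single : ∀ {xs : List A} {f t} → Unique xs → t ∈ₗ xs →
             (∀ {x} → x ∈ₗ xs → x ≢ t → f x ≡ 0) → ∑ xs f ≡ f t
∑-≡-single {xs = t ∷ xs} {f} (t∉xs ∷ _) (here refl) others =
  trans (cong (f t +_) (∑-≡0 xs (λ x∈ → others (there x∈) (All.lookup t∉xs x∈ ∘ sym))))
        (+-identityʳ (f t))
∑-≡-single {xs = x ∷ xs} {f} (x∉xs ∷ u) (there t∈) others =
  cong₂ _+_ (others (here refl) (All.lookup x∉xs t∈)) (∑-≡-single u t∈ (others ∘ there))

∑-positive : ∀ (xs : List A) f → 0 < ∑ xs f → Σ A λ x → x ∈ₗ xs × 0 < f x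
∑-positive (x ∷ xs) f pos with f x ≟ 0
... | no  fx≢0 = x , here refl , n≢0⇒n>0 fx≢0
... | yes fx≡0 with y , y∈ , fy>0 ← ∑-positive xs f (subst (λ a → 0 < a + ∑ xs f) fx≡0 pos)
  = y , there y∈ , fy>0

∑-≤1 : ∀ {xs : List A} {f} → Unique xs → (∀ x → f x ≤ 1) →
       (∀ {x y} → x ∈ₗ xs → y ∈ₗ xs → 0 < f x → 0 < f y → x ≡ y) → ∑ xs f ≤ 1
∑-≤1 {xs = xs} {f} u f≤1 at-most-one with ∑ xs f in ∑≡
... | zero  = z≤n
... | suc _ with t , t∈ , ft>0 ← ∑-positive xs f (subst (0 <_) (sym ∑≡) (s≤s z≤n))
  = subst (_≤ 1) (trans (sym (∑-≡-single u t∈ vanish)) ∑≡) (f≤1 t)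
  where
  vanish : ∀ {x} → x ∈ₗ xs → x ≢ t → f x ≡ 0
  vanish {x} x∈ x≢t with f x ≟ 0
  ... | yes fx≡0 = fx≡0
  ... | no  fx≢0 = ⊥-elim (x≢t (at-most-one x∈ t∈ (n≢0⇒n>0 fx≢0) ft>0))

infixl 7 _⊠_
_⊠_ : List ℕ → List ℕ → List ℕ
_⊠_ = cartesianProductWith _+_

∑-⊠ : ∀ xs ys f → ∑ (xs ⊠ ys) f ≡ ∑ xs (λ x → ∑ ys (λ y → f (x + y)))
∑-⊠ []       ys f = refl
∑-⊠ (x ∷ xs) ys f = begin
  ∑ (map (x +_) ys ++ xs ⊠ ys) f        ≡⟨ ∑-++ (map (x +_) ys) (xs ⊠ ys) f ⟩
  ∑ (map (x +_) ys) f + ∑ (xs ⊠ ys) f  ≡⟨ cong₂ _+_ (∑-map (x +_) ys f) (∑-⊠ xs ys f) ⟩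
  ∑ ys (λ y → f (x + y)) + ∑ xs (λ x → ∑ ys (λ y → f (x + y))) ∎
  where open ≡-Reasoning

length-⊠ : ∀ xs ys → length (xs ⊠ ys) ≡ length xs * length ys
length-⊠ []       ys = refl
length-⊠ (x ∷ xs) ys = trans (length-++ (map (x +_) ys))
                             (cong₂ _+_ (length-map (x +_) ys) (length-⊠ xs ys))

∑-⊠-identityˡ : ∀ xs f → ∑ ((0 ∷ []) ⊠ xs) f ≡ ∑ xs f
∑-⊠-identityˡ xs f = trans (∑-⊠ (0 ∷ []) xs f) (+-identityʳ (∑ xs f))

∑-⊠-assoc : ∀ xs ys zs f → ∑ ((xs ⊠ ys) ⊠ zs) f ≡ ∑ (xs ⊠ (ys ⊠ zs)) f
∑-⊠-assoc xs ys zs f = begin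
  ∑ ((xs ⊠ ys) ⊠ zs) f
    ≡⟨ ∑-⊠ (xs ⊠ ys) zs f ⟩
  ∑ (xs ⊠ ys) (λ w → ∑ zs (λ z → f (w + z)))
    ≡⟨ ∑-⊠ xs ys _ ⟩
  ∑ xs (λ x → ∑ ys (λ y → ∑ zs (λ z → f (x + y + z))))
    ≡⟨ ∑-cong xs (λ x → ∑-cong ys (λ y → ∑-cong zs (λ z → cong f (+-assoc x y z)))) ⟩
  ∑ xs (λ x → ∑ ys (λ y → ∑ zs (λ z → f (x + (y + z)))))
    ≡⟨ ∑-cong xs (λ x → ∑-⊠ ys zs _) ⟨
  ∑ xs (λ x → ∑ (ys ⊠ zs) (λ w → f (x + w)))
    ≡⟨ ∑-⊠ xs (ys ⊠ zs) f ⟨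
  ∑ (xs ⊠ (ys ⊠ zs)) f
    ∎
  where open ≡-Reasoning

∑-⊠-comm : ∀ xs ys f → ∑ (xs ⊠ ys) f ≡ ∑ (ys ⊠ xs) f
∑-⊠-comm xs ys f = begin
  ∑ (xs ⊠ ys) f                         ≡⟨ ∑-⊠ xs ys f ⟩
  ∑ xs (λ x → ∑ ys (λ y → f (x + y)))   ≡⟨ ∑-swap xs ys _ ⟩
  ∑ ys (λ y → ∑ xs (λ x → f (x + y)))   ≡⟨ ∑-cong ys (λ y → ∑-cong xs (λ x → cong f (+-comm x y))) ⟩
  ∑ ys (λ y → ∑ xs (λ x → f (y + x)))   ≡⟨ ∑-⊠ ys xs f ⟨
  ∑ (ys ⊠ xs) f                         ∎
  where open ≡-Reasoning

[k+1]*[n+1]C[k+1]≡[n+1]*nCk : ∀ n k → suc k * (suc n C suc k) ≡ suc n * (n C k)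
[k+1]*[n+1]C[k+1]≡[n+1]*nCk zero    zero    = refl
[k+1]*[n+1]C[k+1]≡[n+1]*nCk zero    (suc k) = *-zeroʳ (2+ k)
[k+1]*[n+1]C[k+1]≡[n+1]*nCk (suc n) zero    =
  trans (*-identityˡ _) (trans (nC1≡n (2+ n)) (sym (*-identityʳ _)))
[k+1]*[n+1]C[k+1]≡[n+1]*nCk (suc n) (suc k) = begin
  2+ k * (2+ n C 2+ k)
    ≡⟨ cong (2+ k *_) (nCk+nC[k+1]≡[n+1]C[k+1] (suc n) (suc k)) ⟨
  2+ k * (c₁ + c₂)
    ≡⟨ *-distribˡ-+ (2+ k) c₁ c₂ ⟩
  (c₁ + suc k * c₁) + 2+ k * c₂
    ≡⟨ cong₂ (λ u v → (c₁ + u) + v) ([k+1]*[n+1]C[k+1]≡[n+1]*nCk n k)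
                                    ([k+1]*[n+1]C[k+1]≡[n+1]*nCk n (suc k)) ⟩
  (c₁ + suc n * (n C k)) + suc n * (n C suc k)
    ≡⟨ +-assoc c₁ _ _ ⟩
  c₁ + (suc n * (n C k) + suc n * (n C suc k))
    ≡⟨ cong (c₁ +_) (*-distribˡ-+ (suc n) (n C k) (n C suc k)) ⟨
  c₁ + suc n * (n C k + n C suc k)
    ≡⟨ cong (λ u → c₁ + suc n * u) (nCk+nC[k+1]≡[n+1]C[k+1] n k) ⟩
  c₁ + suc n * c₁
    ∎
  where
  open ≡-Reasoning
  c₁ = suc n C suc k
  c₂ = suc n C 2+ k

p∣pCk : ∀ {p k} → Prime p → 0 < k → k < p → p ∣ p C k
p∣pCk {suc n} {suc k} p-prime _ k<p
  with euclidsLemma (suc k) (suc n C suc k) p-prime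
         (divides (n C k) (trans ([k+1]*[n+1]C[k+1]≡[n+1]*nCk n k) (*-comm (suc n) (n C k))))
... | inj₁ p∣k+1 = contradiction (∣⇒≤ p∣k+1) (<⇒≱ k<p)
... | inj₂ p∣pCk = p∣pCk

module MonoidRingMod (p : ℕ) .{{_ : NonZero p}} where

  -- Lists of naturals are multisets, i.e. elements of the monoid semiring ℕ[ℕ] with sum _++_
  -- and product _⊠_; _≈_ is equality in 𝔽ₚ[ℕ].
  infix 4 _≈_
  record _≈_ (xs ys : List ℕ) : Set where
    constructor mk≈
    field ∑-≡-mod : ∀ f → ∑ xs f % p ≡ ∑ ys f % p
  open _≈_ public

  ≈-of-∑≡ : ∀ {xs ys} → (∀ f → ∑ xs f ≡ ∑ ys f) → xs ≈ ys
  ≈-of-∑≡ ∑≡ = mk≈ λ f → cong (_% p) (∑≡ f)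

  ≈-reflexive : ∀ {xs ys} → xs ≡ ys → xs ≈ ys
  ≈-reflexive refl = mk≈ λ f → refl

  ≈-refl : ∀ {xs} → xs ≈ xs
  ≈-refl = ≈-reflexive refl

  ≈-isEquivalence : IsEquivalence _≈_
  ≈-isEquivalence = record
    { refl  = ≈-refl
    ; sym   = λ x≈y → mk≈ λ f → sym (∑-≡-mod x≈y f)
    ; trans = λ x≈y y≈z → mk≈ λ f → trans (∑-≡-mod x≈y f) (∑-≡-mod y≈z f)
    }

  +-cong-% : ∀ {a b c d} → a % p ≡ b % p → c % p ≡ d % p → (a + c) % p ≡ (b + d) % p
  +-cong-% {a} {b} {c} {d} a≡b c≡d = begin
    (a + c) % p            ≡⟨ %-distribˡ-+ a c p ⟩
    (a % p + c % p) % p    ≡⟨ cong₂ (λ u v → (u + v) % p) a≡b c≡d ⟩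
    (b % p + d % p) % p    ≡⟨ %-distribˡ-+ b d p ⟨
    (b + d) % p            ∎
    where open ≡-Reasoning

  ∑-cong-% : ∀ (xs : List A) {f g} → (∀ x → f x % p ≡ g x % p) → ∑ xs f % p ≡ ∑ xs g % p
  ∑-cong-% []       f≡g = refl
  ∑-cong-% (x ∷ xs) f≡g = +-cong-% (f≡g x) (∑-cong-% xs f≡g)

  ++-cong : ∀ {a b c d} → a ≈ b → c ≈ d → a ++ c ≈ b ++ d
  ++-cong {a} {b} {c} {d} a≈b c≈d = mk≈ λ f → begin
    ∑ (a ++ c) f % p      ≡⟨ cong (_% p) (∑-++ a c f) ⟩
    (∑ a f + ∑ c f) % p   ≡⟨ +-cong-% (∑-≡-mod a≈b f) (∑-≡-mod c≈d f) ⟩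
    (∑ b f + ∑ d f) % p   ≡⟨ cong (_% p) (∑-++ b d f) ⟨
    ∑ (b ++ d) f % p      ∎
    where open ≡-Reasoning

  ⊠-cong : ∀ {a b c d} → a ≈ b → c ≈ d → a ⊠ c ≈ b ⊠ d
  ⊠-cong {a} {b} {c} {d} a≈b c≈d = mk≈ λ f → begin
    ∑ (a ⊠ c) f % p                         ≡⟨ cong (_% p) (∑-⊠ a c f) ⟩
    ∑ a (λ x → ∑ c (λ y → f (x + y))) % p   ≡⟨ ∑-cong-% a (λ x → ∑-≡-mod c≈d (λ y → f (x + y))) ⟩
    ∑ a (λ x → ∑ d (λ y → f (x + y))) % p   ≡⟨ ∑-≡-mod a≈b (λ x → ∑ d (λ y → f (x + y))) ⟩
    ∑ b (λ x → ∑ d (λ y → f (x + y))) % p   ≡⟨ cong (_% p) (∑-⊠ b d f) ⟨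
    ∑ (b ⊠ d) f % p                         ∎
    where open ≡-Reasoning

  isCommutativeSemiring : IsCommutativeSemiring _≈_ _++_ _⊠_ [] (0 ∷ [])
  isCommutativeSemiring = Biased.isCommutativeSemiringˡ record
    { +-isCommutativeMonoid = Biased.isCommutativeMonoidˡ record
      { isSemigroup = record
        { isMagma = record { isEquivalence = ≈-isEquivalence ; ∙-cong = ++-cong }
        ; assoc   = λ a b c → ≈-reflexive (++-assoc a b c)
        }
      ; identityˡ = λ a → ≈-refl
      ; comm      = λ a b → ≈-of-∑≡ (∑-++-comm a b)
      }
    ; *-isCommutativeMonoid = Biased.isCommutativeMonoidˡ record
      { isSemigroup = record
        { isMagma = record { isEquivalence = ≈-isEquivalence ; ∙-cong = ⊠-cong }
        ; assoc   = λ a b c → ≈-of-∑≡ (∑-⊠-assoc a b c)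
        }
      ; identityˡ = λ a → ≈-of-∑≡ (∑-⊠-identityˡ a)
      ; comm      = λ a b → ≈-of-∑≡ (∑-⊠-comm a b)
      }
    ; distribʳ = λ a b c → ≈-reflexive (cartesianProductWith-distribʳ-++ _+_ b c a)
    ; zeroˡ    = λ a → ≈-refl
    }

  commutativeSemiring : CommutativeSemiring _ _
  commutativeSemiring = record { isCommutativeSemiring = isCommutativeSemiring }

  open CommutativeSemiring commutativeSemiring public using (semiring)
  open import Algebra.Properties.Semiring.Exp semiring public
    using () renaming (_^_ to _⊠^_)
  open import Algebra.Properties.Semiring.Mult semiring public
    using () renaming (_×_ to _·_)

  ∑-· : ∀ c xs f → ∑ (c · xs) f ≡ c * ∑ xs f
  ∑-· zero    xs f = refl
  ∑-· (suc c) xs f = trans (∑-++ xs (c · xs) f) (cong (∑ xs f +_) (∑-· c xs f))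

  p∣c⇒c·xs≈[] : ∀ {c} xs → p ∣ c → c · xs ≈ []
  p∣c⇒c·xs≈[] {c} xs p∣c = mk≈ λ f → begin
    ∑ (c · xs) f % p    ≡⟨ cong (_% p) (∑-· c xs f) ⟩
    c * ∑ xs f % p      ≡⟨ n∣m⇒m%n≡0 _ p (∣m⇒∣m*n (∑ xs f) p∣c) ⟩
    0                   ≡⟨ m<n⇒m%n≡m (>-nonZero⁻¹ p) ⟨
    0 % p               ∎
    where open ≡-Reasoning

  length-⊠^ : ∀ xs j → length (xs ⊠^ j) ≡ length xs ^ j
  length-⊠^ xs zero    = refl
  length-⊠^ xs (suc j) = trans (length-⊠ xs (xs ⊠^ j)) (cong (length xs *_) (length-⊠^ xs j))

  [x]⊠^j≡[j*x] : ∀ x j → (x ∷ []) ⊠^ j ≡ j * x ∷ []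
  [x]⊠^j≡[j*x] x zero    = refl
  [x]⊠^j≡[j*x] x (suc j) rewrite [x]⊠^j≡[j*x] x j = refl

module Frobenius {q : ℕ} (p-prime : Prime (suc q)) where

  private
    p = suc q

  open MonoidRingMod p
  open CommutativeSemiring commutativeSemiring using (setoid)
    renaming (trans to ≈-trans; *-identityˡ to ⊠-identityˡ; *-identityʳ to ⊠-identityʳ)
  open import Algebra.Properties.Semiring.Mult semiring using (×-homo-1)
  open import Algebra.Properties.Semiring.Sum semiring
    using (sum-init-last; sum-cong-≋; sum-replicate-zero) renaming (sum to sumᵥ)
  open import Algebra.Properties.CommutativeSemiring.Binomial commutativeSemiring
    using (theorem; binomialTerm)
  open import Data.Vec.Functional using (init; tail)
  open import Relation.Binary.Reasoning.Setoid setoid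

  frobenius-++ : ∀ xs ys → (xs ++ ys) ⊠^ p ≈ ys ⊠^ p ++ xs ⊠^ p
  frobenius-++ xs ys = begin
    (xs ++ ys) ⊠^ p
      ≈⟨ theorem p xs ys ⟩
    t zero ++ sumᵥ (tail t)
      ≈⟨ ++-cong lowest (sum-init-last (tail t)) ⟩
    ys ⊠^ p ++ (sumᵥ (init (tail t)) ++ t (suc (fromℕ q)))
      ≈⟨ ++-cong ≈-refl (++-cong middle (highest _ (cong suc (toℕ-fromℕ q)))) ⟩
    ys ⊠^ p ++ xs ⊠^ p
      ∎
    where
    t = binomialTerm xs ys p
    lowest : t zero ≈ ys ⊠^ p
    lowest = ≈-trans (×-homo-1 _) (⊠-identityˡ _)
    middle : sumᵥ (init (tail t)) ≈ []
    middle = ≈-trans (sum-cong-≋ vanish) (sum-replicate-zero q)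
      where
      vanish : ∀ i → t (suc (inject₁ i)) ≈ []
      vanish i = p∣c⇒c·xs≈[] _ (p∣pCk p-prime (s≤s z≤n)
        (s≤s (subst (_< q) (sym (toℕ-inject₁ i)) (toℕ<n i))))
    -- Stated for all j ≡ p: the top index toℕ (suc (fromℕ q)) equals p only propositionally.
    highest : ∀ j → j ≡ p → (p C j) · ((xs ⊠^ j) ⊠ (ys ⊠^ (p ∸ j))) ≈ xs ⊠^ p
    highest _ refl rewrite nCn≡1 p | n∸n≡0 p = ≈-trans (×-homo-1 _) (⊠-identityʳ _)

  frobenius : ∀ xs → xs ⊠^ p ≈ map (p *_) xs
  frobenius []       = ≈-refl
  frobenius (x ∷ xs) = begin
    ((x ∷ []) ++ xs) ⊠^ p           ≈⟨ frobenius-++ (x ∷ []) xs ⟩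
    xs ⊠^ p ++ (x ∷ []) ⊠^ p        ≈⟨ ++-cong (frobenius xs) (≈-reflexive ([x]⊠^j≡[j*x] x p)) ⟩
    map (p *_) xs ++ (p * x ∷ [])   ≈⟨ ≈-of-∑≡ (∑-++-comm (map (p *_) xs) (p * x ∷ [])) ⟩
    map (p *_) (x ∷ xs)             ∎

δ₀ : ℕ → ℕ
δ₀ zero    = 1
δ₀ (suc _) = 0

δ₀≤1 : ∀ n → δ₀ n ≤ 1
δ₀≤1 zero    = s≤s z≤n
δ₀≤1 (suc _) = z≤n

δ₀>0⇒≡0 : ∀ {n} → 0 < δ₀ n → n ≡ 0
δ₀>0⇒≡0 {zero} _ = refl

δ₀-≢0 : ∀ {n} → n ≢ 0 → δ₀ n ≡ 0
δ₀-≢0 {zero}  n≢0 = contradiction refl n≢0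
δ₀-≢0 {suc _} _   = refl

p∣m^n⇒p∣m : ∀ {p} m n → Prime p → p ∣ m ^ n → p ∣ m
p∣m^n⇒p∣m m zero    p-prime p∣1 =
  contradiction (∣1⇒≡1 p∣1) (nonTrivial⇒≢1 {{prime⇒nonTrivial p-prime}})
p∣m^n⇒p∣m m (suc n) p-prime p∣m^[1+n] with euclidsLemma m (m ^ n) p-prime p∣m^[1+n]
... | inj₁ p∣m   = p∣m
... | inj₂ p∣m^n = p∣m^n⇒p∣m m n p-prime p∣m^n

module Residues (d : ℕ) .{{_ : NonZero d}} where

  [m%d+n]%d≡[m+n]%d : ∀ m n → (m % d + n) % d ≡ (m + n) % d
  [m%d+n]%d≡[m+n]%d m n = begin
    (m % d + n) % d          ≡⟨ %-distribˡ-+ (m % d) n d ⟩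
    (m % d % d + n % d) % d  ≡⟨ cong (λ u → (u + n % d) % d) (m%n%n≡m%n m d) ⟩
    (m % d + n % d) % d      ≡⟨ %-distribˡ-+ m n d ⟨
    (m + n) % d              ∎
    where open ≡-Reasoning

  [m+n%d]%d≡[m+n]%d : ∀ m n → (m + n % d) % d ≡ (m + n) % d
  [m+n%d]%d≡[m+n]%d m n = begin
    (m + n % d) % d  ≡⟨ cong (_% d) (+-comm m (n % d)) ⟩
    (n % d + m) % d  ≡⟨ [m%d+n]%d≡[m+n]%d n m ⟩
    (n + m) % d      ≡⟨ cong (_% d) (+-comm n m) ⟩
    (m + n) % d      ∎
    where open ≡-Reasoning

  %-congˡ-+ : ∀ {m n} w → m % d ≡ n % d → (m + w) % d ≡ (n + w) % d
  %-congˡ-+ {m} {n} w eq = begin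
    (m + w) % d       ≡⟨ [m%d+n]%d≡[m+n]%d m w ⟨
    (m % d + w) % d   ≡⟨ cong (λ u → (u + w) % d) eq ⟩
    (n % d + w) % d   ≡⟨ [m%d+n]%d≡[m+n]%d n w ⟩
    (n + w) % d       ∎
    where open ≡-Reasoning

  neg : ℕ → ℕ
  neg m = (d ∸ m % d) % d

  neg<d : ∀ m → neg m < d
  neg<d m = m%n<n (d ∸ m % d) d

  [m+neg[m]]%d≡0 : ∀ m → (m + neg m) % d ≡ 0
  [m+neg[m]]%d≡0 m = begin
    (m + neg m) % d              ≡⟨ [m+n%d]%d≡[m+n]%d m (d ∸ m % d) ⟩
    (m + (d ∸ m % d)) % d        ≡⟨ [m%d+n]%d≡[m+n]%d m (d ∸ m % d) ⟨
    (m % d + (d ∸ m % d)) % d    ≡⟨ cong (_% d) (m+[n∸m]≡n (m%n≤n m d)) ⟩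
    d % d                        ≡⟨ n%n≡0 d ⟩
    0                            ∎
    where open ≡-Reasoning

  [m+[neg[m]+n]]%d≡n%d : ∀ m n → (m + (neg m + n)) % d ≡ n % d
  [m+[neg[m]+n]]%d≡n%d m n = begin
    (m + (neg m + n)) % d        ≡⟨ cong (_% d) (+-assoc m (neg m) n) ⟨
    (m + neg m + n) % d          ≡⟨ [m%d+n]%d≡[m+n]%d (m + neg m) n ⟨
    ((m + neg m) % d + n) % d    ≡⟨ cong (λ u → (u + n) % d) ([m+neg[m]]%d≡0 m) ⟩
    n % d                        ∎
    where open ≡-Reasoning

  %-cancelˡ : ∀ v m n → (v + m) % d ≡ (v + n) % d → m % d ≡ n % d
  %-cancelˡ v m n eq = begin
    m % d                        ≡⟨ cancel m ⟨
    (neg v + (v + m)) % d        ≡⟨ [m+n%d]%d≡[m+n]%d (neg v) (v + m) ⟨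
    (neg v + (v + m) % d) % d    ≡⟨ cong (λ u → (neg v + u) % d) eq ⟩
    (neg v + (v + n) % d) % d    ≡⟨ [m+n%d]%d≡[m+n]%d (neg v) (v + n) ⟩
    (neg v + (v + n)) % d        ≡⟨ cancel n ⟩
    n % d                        ∎
    where
    open ≡-Reasoning
    cancel : ∀ k → (neg v + (v + k)) % d ≡ k % d
    cancel k = trans (cong (_% d) (x∙yz≈y∙xz (neg v) v k)) ([m+[neg[m]+n]]%d≡n%d v k)

  %-cancelʳ : ∀ m n w → (m + w) % d ≡ (n + w) % d → m % d ≡ n % d
  %-cancelʳ m n w eq =
    %-cancelˡ w m n (trans (cong (_% d) (+-comm w m)) (trans eq (cong (_% d) (+-comm n w))))

  [m+n]%d≡m%d⇒d∣n : ∀ m n → (m + n) % d ≡ m % d → d ∣ n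
  [m+n]%d≡m%d⇒d∣n m n eq = m%n≡0⇒n∣m n d (begin
    n % d    ≡⟨ %-cancelˡ m n 0 (trans eq (cong (_% d) (sym (+-identityʳ m)))) ⟩
    0 % d    ≡⟨ m<n⇒m%n≡m (>-nonZero⁻¹ d) ⟩
    0        ∎)
    where open ≡-Reasoning

  ≤∧%≡%⇒∣∸ : ∀ {m n} → m ≤ n → m % d ≡ n % d → d ∣ n ∸ m
  ≤∧%≡%⇒∣∸ {m} {n} m≤n eq =
    [m+n]%d≡m%d⇒d∣n m (n ∸ m) (trans (cong (_% d) (m+[n∸m]≡n m≤n)) (sym eq))

  ≤∧∣∸⇒%≡% : ∀ {m n} → m ≤ n → d ∣ n ∸ m → n % d ≡ m % d
  ≤∧∣∸⇒%≡% {m} {n} m≤n d∣n∸m =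
    trans (cong (_% d) (sym (m+[n∸m]≡n m≤n))) (%-remove-+ʳ m d∣n∸m)

  %≡%⇒∣∣-∣ : ∀ m n → m % d ≡ n % d → d ∣ ∣ m - n ∣
  %≡%⇒∣∣-∣ m n eq with ≤-total m n
  ... | inj₁ m≤n = subst (d ∣_) (sym (m≤n⇒∣m-n∣≡n∸m m≤n)) (≤∧%≡%⇒∣∸ m≤n eq)
  ... | inj₂ n≤m = subst (d ∣_) (sym (m≤n⇒∣n-m∣≡n∸m n≤m)) (≤∧%≡%⇒∣∸ n≤m (sym eq))

  ∣∣-∣⇒%≡% : ∀ m n → d ∣ ∣ m - n ∣ → m % d ≡ n % d
  ∣∣-∣⇒%≡% m n d∣ with ≤-total m n
  ... | inj₁ m≤n = sym (≤∧∣∸⇒%≡% m≤n (subst (d ∣_) (m≤n⇒∣m-n∣≡n∸m m≤n) d∣))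
  ... | inj₂ n≤m = ≤∧∣∸⇒%≡% n≤m (subst (d ∣_) (m≤n⇒∣n-m∣≡n∸m n≤m) d∣)

  -- count xs g is the multiplicity of the residue −g in xs. Counting −g rather than g turns
  -- a translation by y into g ↦ y + g, with no truncated subtraction.
  count : List ℕ → ℕ → ℕ
  count xs g = ∑ xs (λ z → δ₀ ((z + g) % d))

  count-mod : ∀ xs g → count xs g ≡ count xs (g % d)
  count-mod xs g = ∑-cong xs (λ z → cong δ₀ (sym ([m+n%d]%d≡[m+n]%d z g)))

  ∑-upTo-δ₀ : ∀ z → ∑ (upTo d) (λ g → δ₀ ((z + g) % d)) ≡ 1
  ∑-upTo-δ₀ z = trans (∑-≡-single (Unique.upTo⁺ d) (∈-upTo⁺ (neg<d z)) others)
                      (cong δ₀ ([m+neg[m]]%d≡0 z))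
    where
    others : ∀ {g} → g ∈ₗ upTo d → g ≢ neg z → δ₀ ((z + g) % d) ≡ 0
    others {g} g∈ g≢ = δ₀-≢0 λ eq → g≢ (begin
      g          ≡⟨ m<n⇒m%n≡m (∈-upTo⁻ g∈) ⟨
      g % d      ≡⟨ %-cancelˡ z g (neg z) (trans eq (sym ([m+neg[m]]%d≡0 z))) ⟩
      neg z % d  ≡⟨ m<n⇒m%n≡m (neg<d z) ⟩
      neg z      ∎)
      where open ≡-Reasoning

  ∑-upTo-1 : ∑ (upTo d) (λ _ → 1) ≡ d
  ∑-upTo-1 = trans (∑-1≡length (upTo d)) (length-upTo d)

  count-total : ∀ xs → ∑ (upTo d) (count xs) ≡ length xs
  count-total xs = begin
    ∑ (upTo d) (λ g → ∑ xs (λ z → δ₀ ((z + g) % d)))   ≡⟨ ∑-swap (upTo d) xs _ ⟩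
    ∑ xs (λ z → ∑ (upTo d) (λ g → δ₀ ((z + g) % d)))   ≡⟨ ∑-cong xs ∑-upTo-δ₀ ⟩
    ∑ xs (λ _ → 1)                                     ≡⟨ ∑-1≡length xs ⟩
    length xs                                          ∎
    where open ≡-Reasoning

  count≡1-if-≥1 : ∀ xs → length xs ≡ d → (∀ g → 1 ≤ count xs g) → ∀ g → count xs g ≡ 1
  count≡1-if-≥1 xs length≡d 1≤count g = trans (count-mod xs g) (sym
    (∑-tight (upTo d) 1≤count (trans ∑-upTo-1 (sym (trans (count-total xs) length≡d)))
             (∈-upTo⁺ (m%n<n g d))))

  count≡1-if-≤1 : ∀ xs → length xs ≡ d → (∀ g → count xs g ≤ 1) → ∀ g → count xs g ≡ 1
  count≡1-if-≤1 xs length≡d count≤1 g = trans (count-mod xs g)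
    (∑-tight (upTo d) count≤1 (trans (count-total xs) (trans length≡d (sym ∑-upTo-1)))
             (∈-upTo⁺ (m%n<n g d)))

  record Tile (xs as : List ℕ) : Set where
    constructor mkTile
    field count-⊠≡1 : ∀ g → count (xs ⊠ as) g ≡ 1
  open Tile public

  tile-length : ∀ {xs as} → Tile xs as → length xs * length as ≡ d
  tile-length {xs} {as} tile = begin
    length xs * length as          ≡⟨ length-⊠ xs as ⟨
    length (xs ⊠ as)               ≡⟨ count-total (xs ⊠ as) ⟨
    ∑ (upTo d) (count (xs ⊠ as))   ≡⟨ ∑-cong (upTo d) (count-⊠≡1 tile) ⟩
    ∑ (upTo d) (λ _ → 1)           ≡⟨ ∑-upTo-1 ⟩
    d                              ∎
    where open ≡-Reasoning

  tile⇒count≤1 : ∀ {xs as} → Tile xs as → ∀ g → count xs g ≤ 1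
  tile⇒count≤1 {xs} {[]} tile g =
    contradiction (trans (sym (*-zeroʳ (length xs))) (tile-length tile)) (≢-nonZero⁻¹ d ∘ sym)
  tile⇒count≤1 {xs} {a ∷ as} tile g = begin
    count xs g
      ≡⟨ ∑-cong xs (λ x → cong δ₀ (shift x)) ⟩
    ∑ xs (λ x → δ₀ ((x + a + (neg a + g)) % d))
      ≤⟨ ∑-mono-≤ xs (λ x →
           ∑-≥-∈ {xs = a ∷ as} (λ b → δ₀ ((x + b + (neg a + g)) % d)) (here refl)) ⟩
    ∑ xs (λ x → ∑ (a ∷ as) (λ b → δ₀ ((x + b + (neg a + g)) % d)))
      ≡⟨ ∑-⊠ xs (a ∷ as) _ ⟨
    count (xs ⊠ (a ∷ as)) (neg a + g)
      ≡⟨ count-⊠≡1 tile (neg a + g) ⟩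
    1 ∎
    where
    open ≤-Reasoning
    shift : ∀ x → (x + g) % d ≡ (x + a + (neg a + g)) % d
    shift x = begin-equality
      (x + g) % d                       ≡⟨ [m+n%d]%d≡[m+n]%d x g ⟨
      (x + g % d) % d                   ≡⟨ cong (λ u → (x + u) % d) ([m+[neg[m]+n]]%d≡n%d a g) ⟨
      (x + (a + (neg a + g)) % d) % d   ≡⟨ [m+n%d]%d≡[m+n]%d x (a + (neg a + g)) ⟩
      (x + (a + (neg a + g))) % d       ≡⟨ cong (_% d) (+-assoc x a (neg a + g)) ⟨
      (x + a + (neg a + g)) % d         ∎

  count-⊠-tile : ∀ {xs as} → Tile xs as → ∀ ys g → count ((xs ⊠ ys) ⊠ as) g ≡ length ys
  count-⊠-tile {xs} {as} tile ys g = begin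
    ∑ ((xs ⊠ ys) ⊠ as) F
      ≡⟨ ∑-⊠ (xs ⊠ ys) as F ⟩
    ∑ (xs ⊠ ys) (λ w → ∑ as (λ a → F (w + a)))
      ≡⟨ ∑-⊠-comm xs ys _ ⟩
    ∑ (ys ⊠ xs) (λ w → ∑ as (λ a → F (w + a)))
      ≡⟨ ∑-⊠ ys xs _ ⟩
    ∑ ys (λ y → ∑ xs (λ x → ∑ as (λ a → F (y + x + a))))
      ≡⟨ ∑-cong ys (λ y → ∑-cong xs (λ x → ∑-cong as (λ a →
           cong (λ u → δ₀ (u % d)) (rearrange y x a g)))) ⟩
    ∑ ys (λ y → ∑ xs (λ x → ∑ as (λ a → δ₀ ((x + a + (y + g)) % d))))
      ≡⟨ ∑-cong ys (λ y → trans (sym (∑-⊠ xs as _)) (count-⊠≡1 tile (y + g))) ⟩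
    ∑ ys (λ _ → 1)
      ≡⟨ ∑-1≡length ys ⟩
    length ys
      ∎
    where
    open ≡-Reasoning
    F : ℕ → ℕ
    F z = δ₀ ((z + g) % d)
    rearrange : ∀ y x a g → y + x + a + g ≡ x + a + (y + g)
    rearrange = solve-∀

  multiplier-prime : ∀ {p xs as} → Prime p → ¬ p ∣ length xs →
                     Tile xs as → Tile (map (p *_) xs) as
  multiplier-prime {zero} ()
  multiplier-prime {suc q} {xs} {as} p-prime p∤∣xs∣ tile =
    mkTile (count≡1-if-≥1 ys length≡d (λ g → n≢0⇒n>0 (count≢0 g)))
    where
    open MonoidRingMod (suc q)
    open Frobenius p-prime
    p = suc q
    ys = map (p *_) xs ⊠ as
    count≡∣xs∣^q : ∀ g → count ys g % p ≡ length xs ^ q % p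
    count≡∣xs∣^q g = begin
      count ys g % p                      ≡⟨ ∑-≡-mod (⊠-cong (frobenius xs) ≈-refl) _ ⟨
      count ((xs ⊠ xs ⊠^ q) ⊠ as) g % p   ≡⟨ cong (_% p) (count-⊠-tile tile (xs ⊠^ q) g) ⟩
      length (xs ⊠^ q) % p                ≡⟨ cong (_% p) (length-⊠^ xs q) ⟩
      length xs ^ q % p                   ∎
      where open ≡-Reasoning
    count≢0 : ∀ g → count ys g ≢ 0
    count≢0 g count≡0 = p∤∣xs∣ (p∣m^n⇒p∣m (length xs) q p-prime
      (m%n≡0⇒n∣m _ p (trans (sym (count≡∣xs∣^q g)) (cong (_% p) count≡0))))
    length≡d : length ys ≡ d
    length≡d = trans (length-⊠ (map (p *_) xs) as)
                     (trans (cong (_* length as) (length-map (p *_) xs)) (tile-length tile))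

  multiplier-product : ∀ {xs as} ps → All Prime ps → Coprime (product ps) (length xs) →
                       Tile xs as → Tile (map (product ps *_) xs) as
  multiplier-product {xs} {as} [] [] _ tile =
    subst (λ ys → Tile ys as) (sym (trans (map-cong *-identityˡ xs) (map-id xs))) tile
  multiplier-product {xs} {as} (p ∷ ps) (p-prime ∷ ps-prime) coprime tile =
    subst (λ ys → Tile ys as)
          (trans (sym (map-∘ xs)) (map-cong (λ x → sym (*-assoc p (product ps) x)) xs))
          (multiplier-prime p-prime p∤∣xs∣ (multiplier-product ps ps-prime coprime′ tile))
    where
    p∤∣xs∣ : ¬ p ∣ length (map (product ps *_) xs)
    p∤∣xs∣ p∣ = nonTrivial⇒≢1 {{prime⇒nonTrivial p-prime}}
      (coprime (m∣m*n (product ps) , subst (p ∣_) (length-map (product ps *_) xs) p∣))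
    coprime′ : Coprime (product ps) (length xs)
    coprime′ (i∣ps , i∣∣xs∣) = coprime (∣n⇒∣m*n p i∣ps , i∣∣xs∣)

  multiplier : ∀ {t xs as} .{{_ : NonZero t}} → Coprime t (length xs) →
               Tile xs as → Tile (map (t *_) xs) as
  multiplier {t} {xs} {as} coprime tile =
    subst (λ u → Tile (map (u *_) xs) as) (sym isFactorisation)
      (multiplier-product factors factorsPrime
        (subst (λ u → Coprime u (length xs)) isFactorisation coprime) tile)
    where open PrimeFactorisation (factorise t)

elements : ∀ {n} → Subset n → List (Fin n)
elements []          = []
elements (true ∷ p)  = zero ∷ map suc (elements p)
elements (false ∷ p) = map suc (elements p)

length-elements : ∀ {n} (p : Subset n) → length (elements p) ≡ ∣ p ∣
length-elements []          = refl
length-elements (true ∷ p)  = cong suc (trans (length-map suc (elements p)) (length-elements p))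
length-elements (false ∷ p) = trans (length-map suc (elements p)) (length-elements p)

∈-elements⁺ : ∀ {n} {p : Subset n} {x} → x ∈ p → x ∈ₗ elements p
∈-elements⁺ {p = true ∷ p}  {zero}  here        = here refl
∈-elements⁺ {p = true ∷ p}  {suc x} (there x∈p) = there (∈-map⁺ suc (∈-elements⁺ x∈p))
∈-elements⁺ {p = false ∷ p} {suc x} (there x∈p) = ∈-map⁺ suc (∈-elements⁺ x∈p)

∈-elements⁻ : ∀ {n} {p : Subset n} {x} → x ∈ₗ elements p → x ∈ p
∈-elements⁻ {p = true ∷ p} (here refl) = here
∈-elements⁻ {p = true ∷ p} (there x∈) with y , y∈ , refl ← ∈-map⁻ suc x∈ = there (∈-elements⁻ y∈)
∈-elements⁻ {p = false ∷ p} x∈ with y , y∈ , refl ← ∈-map⁻ suc x∈ = there (∈-elements⁻ y∈)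

elements-unique : ∀ {n} (p : Subset n) → Unique (elements p)
elements-unique []          = []
elements-unique (true ∷ p)  =
  All.map⁺ (All.tabulate λ _ ()) ∷ Unique.map⁺ Fin-suc-injective (elements-unique p)
elements-unique (false ∷ p) = Unique.map⁺ Fin-suc-injective (elements-unique p)

module CyclicGroup (n : ℕ) .{{_ : NonZero n}} where

  open Residues n

  toℕ-⊕ : ∀ (a b : Fin n) → toℕ (a ⊕ b) ≡ (toℕ a + toℕ b) % n
  toℕ-⊕ a b = toℕ-fromℕ< _

  toℕ%n≡toℕ : ∀ (a : Fin n) → toℕ a % n ≡ toℕ a
  toℕ%n≡toℕ a = m<n⇒m%n≡m (toℕ<n a)

  %≡%⇒≡ : ∀ {a b : Fin n} → toℕ a % n ≡ toℕ b % n → a ≡ b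
  %≡%⇒≡ {a} {b} eq = toℕ-injective (trans (sym (toℕ%n≡toℕ a)) (trans eq (toℕ%n≡toℕ b)))

  ⊕-cancelˡ : ∀ v {a b : Fin n} → v ⊕ a ≡ v ⊕ b → a ≡ b
  ⊕-cancelˡ v {a} {b} eq = %≡%⇒≡ (%-cancelˡ (toℕ v) (toℕ a) (toℕ b)
    (trans (sym (toℕ-⊕ v a)) (trans (cong toℕ eq) (toℕ-⊕ v b))))

  _⊖_ : Fin n → Fin n → Fin n
  s ⊖ v = fromℕ< (m%n<n (toℕ s + (n ∸ toℕ v)) n)

  ⊕-⊖ : ∀ v s → v ⊕ (s ⊖ v) ≡ s
  ⊕-⊖ v s = toℕ-injective (begin
    toℕ (v ⊕ (s ⊖ v))                         ≡⟨ toℕ-⊕ v (s ⊖ v) ⟩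
    (toℕ v + toℕ (s ⊖ v)) % n                 ≡⟨ cong (λ u → (toℕ v + u) % n) (toℕ-fromℕ< _) ⟩
    (toℕ v + (toℕ s + (n ∸ toℕ v)) % n) % n   ≡⟨ [m+n%d]%d≡[m+n]%d (toℕ v) _ ⟩
    (toℕ v + (toℕ s + (n ∸ toℕ v))) % n       ≡⟨ cong (_% n) (x∙yz≈y∙xz (toℕ v) (toℕ s) _) ⟩
    (toℕ s + (toℕ v + (n ∸ toℕ v))) % n       ≡⟨ cong (λ u → (toℕ s + u) % n) v+[n∸v]≡n ⟩
    (toℕ s + n) % n                           ≡⟨ [m+n]%n≡m%n (toℕ s) n ⟩
    toℕ s % n                                 ≡⟨ toℕ%n≡toℕ s ⟩
    toℕ s                                     ∎)
    where
    open ≡-Reasoning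
    v+[n∸v]≡n = m+[n∸m]≡n (<⇒≤ (toℕ<n v))

  negate : ℕ → Fin n
  negate g = fromℕ< (neg<d g)

  translate-root : ∀ g (c : Fin n) → (toℕ (negate g ⊕ c) + (n ∸ toℕ c) + g) % n ≡ 0
  translate-root g c = begin
    (toℕ (negate g ⊕ c) + (n ∸ toℕ c) + g) % n       ≡⟨ %-congˡ-+ g (%-congˡ-+ (n ∸ toℕ c) v⊕c≡v+c) ⟩
    (toℕ (negate g) + toℕ c + (n ∸ toℕ c) + g) % n   ≡⟨ cong (λ u → (u + g) % n) v+c+[n∸c]≡v+n ⟩
    (toℕ (negate g) + n + g) % n                     ≡⟨ cong (_% n) (xy∙z≈xz∙y (toℕ (negate g)) n g) ⟩
    (toℕ (negate g) + g + n) % n                     ≡⟨ [m+n]%n≡m%n _ n ⟩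
    (toℕ (negate g) + g) % n                         ≡⟨ cong (λ u → (u + g) % n) (toℕ-fromℕ< _) ⟩
    (neg g + g) % n                                  ≡⟨ cong (_% n) (+-comm (neg g) g) ⟩
    (g + neg g) % n                                  ≡⟨ [m+neg[m]]%d≡0 g ⟩
    0                                                ∎
    where
    open ≡-Reasoning
    v⊕c≡v+c : toℕ (negate g ⊕ c) % n ≡ (toℕ (negate g) + toℕ c) % n
    v⊕c≡v+c = trans (cong (_% n) (toℕ-⊕ (negate g) c)) (m%n%n≡m%n _ n)
    v+c+[n∸c]≡v+n : toℕ (negate g) + toℕ c + (n ∸ toℕ c) ≡ toℕ (negate g) + n
    v+c+[n∸c]≡v+n = trans (+-assoc (toℕ (negate g)) (toℕ c) (n ∸ toℕ c))
                          (cong (toℕ (negate g) +_) (m+[n∸m]≡n (<⇒≤ (toℕ<n c))))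

  translate-root-unique : ∀ g (c s : Fin n) →
                          (toℕ s + (n ∸ toℕ c) + g) % n ≡ 0 → s ≡ negate g ⊕ c
  translate-root-unique g c s root =
    %≡%⇒≡ (%-cancelʳ _ _ (n ∸ toℕ c) (%-cancelʳ _ _ g (trans root (sym (translate-root g c)))))

  multiples : ℕ → Subset n
  multiples k = tabulate (λ c → does (k ∣? toℕ c))

  ∈-multiples⁺ : ∀ {k c} → k ∣ toℕ c → c ∈ multiples k
  ∈-multiples⁺ {k} {c} k∣c =
    lookup⇒[]= c _ (trans (lookup∘tabulate _ c) (dec-true (k ∣? toℕ c) k∣c))

  ∈-multiples⁻ : ∀ {k c} → c ∈ multiples k → k ∣ toℕ c
  ∈-multiples⁻ {k} {c} c∈ with k ∣? toℕ c | trans (sym (lookup∘tabulate _ c)) ([]=⇒lookup c∈)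
  ... | yes k∣c | _  = k∣c
  ... | no  _   | ()

  module _ {k} .{{_ : NonZero k}} (k∣n : k ∣ n) where

    ⊕-multiple-% : ∀ v {c} → c ∈ multiples k → toℕ (v ⊕ c) % k ≡ toℕ v % k
    ⊕-multiple-% v {c} c∈ = begin
      toℕ (v ⊕ c) % k           ≡⟨ cong (_% k) (toℕ-⊕ v c) ⟩
      (toℕ v + toℕ c) % n % k   ≡⟨ m∣n⇒o%n%m≡o%m k n (toℕ v + toℕ c) k∣n ⟩
      (toℕ v + toℕ c) % k       ≡⟨ %-remove-+ʳ (toℕ v) (∈-multiples⁻ c∈) ⟩
      toℕ v % k                 ∎
      where open ≡-Reasoning

    ⊖-multiple : ∀ {s v} → toℕ s % k ≡ toℕ v % k → s ⊖ v ∈ multiples k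
    ⊖-multiple {s} {v} s≡v = ∈-multiples⁺ (subst (k ∣_) (sym (toℕ-fromℕ< _))
      (%-presˡ-∣ (m%n≡0⇒n∣m _ k (begin
        (toℕ s + (n ∸ toℕ v)) % k   ≡⟨ Residues.%-congˡ-+ k (n ∸ toℕ v) s≡v ⟩
        (toℕ v + (n ∸ toℕ v)) % k   ≡⟨ cong (_% k) (m+[n∸m]≡n (<⇒≤ (toℕ<n v))) ⟩
        n % k                       ≡⟨ n∣m⇒m%n≡0 n k k∣n ⟩
        0                           ∎)) k∣n))
      where open ≡-Reasoning

module _ {n} .{{_ : NonZero n}} (S : Subset n) where

  open CyclicGroup n

  residues-cover : ∀ {k} .{{_ : NonZero k}} → ∣ S ∣ ≡ k →
                   (∀ {s s′} → s ∈ S → s′ ∈ S → toℕ s % k ≡ toℕ s′ % k → s ≡ s′) →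
                   ∀ r → Σ (Fin n) λ s → s ∈ S × toℕ s % k ≡ r % k
  residues-cover {k} ∣S∣≡k residue-injective r = cover (∑-positive (elements S) _ count>0)
    where
    open Residues k
    xs = map toℕ (elements S)
    count≤1 : ∀ g → count xs g ≤ 1
    count≤1 g = subst (_≤ 1) (sym (∑-map toℕ (elements S) _))
      (∑-≤1 (elements-unique S) (λ s → δ₀≤1 _) λ s∈ s′∈ root root′ →
        residue-injective (∈-elements⁻ s∈) (∈-elements⁻ s′∈)
          (%-cancelʳ _ _ g (trans (δ₀>0⇒≡0 root) (sym (δ₀>0⇒≡0 root′)))))
    length≡k : length xs ≡ k
    length≡k = trans (length-map toℕ (elements S)) (trans (length-elements S) ∣S∣≡k)
    count>0 : 0 < ∑ (elements S) (λ s → δ₀ ((toℕ s + neg r) % k))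
    count>0 = subst (0 <_)
      (trans (sym (count≡1-if-≤1 xs length≡k count≤1 (neg r))) (∑-map toℕ (elements S) _))
      (s≤s z≤n)
    cover : Σ (Fin n) (λ s → s ∈ₗ elements S × 0 < δ₀ ((toℕ s + neg r) % k)) →
            Σ (Fin n) λ s → s ∈ S × toℕ s % k ≡ r % k
    cover (s , s∈ , root) = s , ∈-elements⁻ s∈ ,
      %-cancelʳ (toℕ s) r (neg r) (trans (δ₀>0⇒≡0 root) (sym ([m+neg[m]]%d≡0 r)))

  multiples-code : SquareFree S → ∣ S ∣ ∣ n →
                   ((s s′ : Fin n) → s ∈ S → s′ ∈ S → s ≢ s′ →
                     ¬ (toℕ s ≡ toℕ s′ [mod ∣ S ∣ ])) →
                   IsTotalPerfectCode S (multiples ∣ S ∣)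
  multiples-code square-free k∣n distinct v =
    code-at (residues-cover refl residue-injective (toℕ v))
    where
    instance
      k≢0 : NonZero ∣ S ∣
      k≢0 = ≢-nonZero λ k≡0 → ≢-nonZero⁻¹ n (0∣⇒≡0 (subst (_∣ n) k≡0 k∣n))

    residue-injective : ∀ {s s′} → s ∈ S → s′ ∈ S → toℕ s % ∣ S ∣ ≡ toℕ s′ % ∣ S ∣ → s ≡ s′
    residue-injective {s} {s′} s∈ s′∈ s≡s′ with s ≟ᶠ s′
    ... | yes s≡s′ = s≡s′
    ... | no  s≢s′ = ⊥-elim (distinct s s′ s∈ s′∈ s≢s′ (Residues.%≡%⇒∣∣-∣ ∣ S ∣ _ _ s≡s′))

    code-at : (Σ (Fin n) λ s → s ∈ S × toℕ s % ∣ S ∣ ≡ toℕ v % ∣ S ∣) →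
              Σ (Fin n) λ c → (c ∈ multiples ∣ S ∣ × Adj S v c) ×
                ((c′ : Fin n) → c′ ∈ multiples ∣ S ∣ → Adj S v c′ → c′ ≡ c)
    code-at (s , s∈S , s≡v) = s ⊖ v , (⊖-multiple k∣n s≡v , v⊕c∈S , v≢c) , unique
      where
      v⊕c∈S : v ⊕ (s ⊖ v) ∈ S
      v⊕c∈S = subst (_∈ S) (sym (⊕-⊖ v s)) s∈S
      v≢c : v ≢ s ⊖ v
      v≢c v≡c = square-free v (subst (λ c → v ⊕ c ∈ S) (sym v≡c) v⊕c∈S)
      unique : (c′ : Fin n) → c′ ∈ multiples ∣ S ∣ → Adj S v c′ → c′ ≡ s ⊖ v
      unique c′ c′∈ (v⊕c′∈S , _) = ⊕-cancelˡ v (trans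
        (residue-injective v⊕c′∈S s∈S (trans (⊕-multiple-% k∣n v c′∈) (sym s≡v)))
        (sym (⊕-⊖ v s)))

  code⇒tile : SquareFree S → ∀ {C} → IsTotalPerfectCode S C →
              Residues.Tile n (map toℕ (elements S)) (map (λ c → n ∸ toℕ c) (elements C))
  code⇒tile square-free {C} code = mkTile count≡1
    where
    open Residues n
    Sℓ = map toℕ (elements S)
    Cℓ = map (λ c → n ∸ toℕ c) (elements C)

    inner : ℕ → Fin n → ℕ
    inner g c = ∑ (elements S) (λ s → δ₀ ((toℕ s + (n ∸ toℕ c) + g) % n))

    count≡∑inner : ∀ g → count (Sℓ ⊠ Cℓ) g ≡ ∑ (elements C) (inner g)
    count≡∑inner g = begin
      count (Sℓ ⊠ Cℓ) g
        ≡⟨ ∑-⊠ Sℓ Cℓ _ ⟩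
      ∑ Sℓ (λ x → ∑ Cℓ (λ a → δ₀ ((x + a + g) % n)))
        ≡⟨ ∑-map toℕ (elements S) _ ⟩
      ∑ (elements S) (λ s → ∑ Cℓ (λ a → δ₀ ((toℕ s + a + g) % n)))
        ≡⟨ ∑-cong (elements S) (λ s → ∑-map _ (elements C) _) ⟩
      ∑ (elements S) (λ s → ∑ (elements C) (λ c → δ₀ ((toℕ s + (n ∸ toℕ c) + g) % n)))
        ≡⟨ ∑-swap (elements S) (elements C) _ ⟩
      ∑ (elements C) (inner g)
        ∎
      where open ≡-Reasoning

    count≡1 : ∀ g → count (Sℓ ⊠ Cℓ) g ≡ 1
    count≡1 g with c₀ , (c₀∈C , v⊕c₀∈S , _) , unique ← code (negate g) = begin
      count (Sℓ ⊠ Cℓ) g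
        ≡⟨ count≡∑inner g ⟩
      ∑ (elements C) (inner g)
        ≡⟨ ∑-≡-single (elements-unique C) (∈-elements⁺ c₀∈C) inner-vanishes ⟩
      inner g c₀
        ≡⟨ ∑-≡-single (elements-unique S) (∈-elements⁺ v⊕c₀∈S) non-root ⟩
      δ₀ ((toℕ (negate g ⊕ c₀) + (n ∸ toℕ c₀) + g) % n)
        ≡⟨ cong δ₀ (translate-root g c₀) ⟩
      1 ∎
      where
      open ≡-Reasoning
      v = negate g
      non-root : ∀ {s} → s ∈ₗ elements S → s ≢ v ⊕ c₀ →
                 δ₀ ((toℕ s + (n ∸ toℕ c₀) + g) % n) ≡ 0
      non-root {s} _ s≢v⊕c₀ = δ₀-≢0 (s≢v⊕c₀ ∘ translate-root-unique g c₀ s)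
      adjacent : ∀ {c} → v ⊕ c ∈ S → Adj S v c
      adjacent v⊕c∈S = v⊕c∈S , λ v≡c → square-free v (subst (λ c → v ⊕ c ∈ S) (sym v≡c) v⊕c∈S)
      inner-vanishes : ∀ {c} → c ∈ₗ elements C → c ≢ c₀ → inner g c ≡ 0
      inner-vanishes {c} c∈ c≢c₀ = ∑-≡0 (elements S) λ {s} s∈ → δ₀-≢0 λ root →
        c≢c₀ (unique c (∈-elements⁻ c∈)
          (adjacent (subst (_∈ S) (translate-root-unique g c s root) (∈-elements⁻ s∈))))

  code⇒distinct-residues : SquareFree S → ∀ {m} → n ≡ ∣ S ∣ * m → gcd ∣ S ∣ m ≡ 1 →
                           ∀ {C} → IsTotalPerfectCode S C →
                           (s s′ : Fin n) → s ∈ S → s′ ∈ S → s ≢ s′ →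
                           ¬ (toℕ s ≡ toℕ s′ [mod ∣ S ∣ ])
  code⇒distinct-residues square-free {m} n≡km gcd≡1 code s s′ s∈S s′∈S s≢s′ k∣s-s′ =
    <⇒≱ (s≤s (s≤s z≤n)) (begin
      2
        ≡⟨ cong₂ _+_ (hit s refl) (hit s′ ms′≡ms) ⟨
      f s + f s′
        ≤⟨ ∑-≥-pair f (∈-elements⁺ s∈S) (∈-elements⁺ s′∈S) s≢s′ ⟩
      ∑ (elements S) f
        ≡⟨ trans (∑-map (m *_) Sℓ _) (∑-map toℕ (elements S) _) ⟨
      count (map (m *_) Sℓ) (neg (m * toℕ s))
        ≤⟨ tile⇒count≤1 (multiplier coprime (code⇒tile square-free code)) _ ⟩
      1 ∎)
    where
    open Residues n
    open ≤-Reasoning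
    instance
      m≢0 : NonZero m
      m≢0 = ≢-nonZero λ m≡0 →
        ≢-nonZero⁻¹ n (trans n≡km (trans (cong (∣ S ∣ *_) m≡0) (*-zeroʳ ∣ S ∣)))
    Sℓ = map toℕ (elements S)
    coprime : Coprime m (length Sℓ)
    coprime = subst (Coprime m) (sym (trans (length-map toℕ (elements S)) (length-elements S)))
                    (Coprime.sym (gcd≡1⇒coprime gcd≡1))
    f : Fin n → ℕ
    f x = δ₀ ((m * toℕ x + neg (m * toℕ s)) % n)
    hit : ∀ x → (m * toℕ x) % n ≡ (m * toℕ s) % n → f x ≡ 1
    hit x eq = cong δ₀ (trans (%-congˡ-+ _ eq) ([m+neg[m]]%d≡0 (m * toℕ s)))
    ms′≡ms : (m * toℕ s′) % n ≡ (m * toℕ s) % n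
    ms′≡ms = ∣∣-∣⇒%≡% _ _ (subst₂ _∣_ (sym n≡km)
      (trans (*-comm _ m) (*-distribˡ-∣-∣ m (toℕ s′) (toℕ s)))
      (*-monoˡ-∣ m (subst (∣ S ∣ ∣_) (∣-∣-comm (toℕ s) (toℕ s′)) k∣s-s′)))

theorem3p13 : (n : ℕ) .{{_ : NonZero n}} → InN n → (S : Subset n) →
              SquareFree S → ∣ S ∣ ∣ n →
              (Σ ℕ λ m → n ≡ ∣ S ∣ * m × gcd ∣ S ∣ m ≡ 1) →
              Connected S →
              (HasTotalPerfectCode S ⇔
                ((s s′ : Fin n) → s ∈ S → s′ ∈ S → s ≢ s′ →
                  ¬ (toℕ s ≡ toℕ s′ [mod ∣ S ∣ ])))
theorem3p13 n _ S square-free k∣n (m , n≡km , gcd≡1) _ = mk⇔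
  (λ (C , code) → code⇒distinct-residues S square-free n≡km gcd≡1 code)
  (λ distinct → CyclicGroup.multiples n ∣ S ∣ , multiples-code S square-free k∣n distinct)
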